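{- Let $P\subset\mathbb{R}^n$ be an $n$-dimensional unimodular smooth Fano polytope with coordinate matrix $M$ (an $m\times n$ matrix, $m>n$). Let $F$ be any facet of $P$ and let $N$ be the $n\times n$ matrix whose rows are the coordinates of the $n$ vertices of $F$. Then the matrix $MN^{ -1}$ (the standard form of the coordinate matrix) is totally unimodular.
   Context: A lattice polytope $P\subset\mathbb{R}^n$ of dimension $n$ is a smooth Fano polytope if it contains the origin in its interior, every vertex is a primitive lattice point of $\mathbb{Z}^n$, every facet has exactly $n$ vertices, and the vertices of every facet form a basis of $\mathbb{Z}^n$ (so $N$ is invertible with integer inverse). The coordinate matrix of $P$ is the matrix whose rows are the coordinates of the vertices of $P$. $P$ is unimodular if every $n\times n$ submatrix of its coordinate matrix has determinant in $\{ -1,0,1\}$. A matrix is totally unimodular if every square submatrix has determinant in $\{ -1,0,1\}$. -}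

module Defs where

open import Data.Nat as ℕ using (ℕ; zero; suc)
open import Data.Fin using (Fin; zero; suc; punchIn; toℕ)
import Data.Fin
import Relation.Nullary
open import Data.Fin.Subset using (Subset; _∈_; _∉_; _⊆_)
open import Data.Integer as ℤ using (ℤ; +_)
open import Data.Rational as ℚ using (ℚ; 0ℚ; 1ℚ)
open import Data.List using (List; foldr; map; allFin)
open import Data.Product using (Σ; ∃; _×_; _,_)
open import Data.Sum using (_⊎_)
open import Function using (_∘_)
open import Function.Definitions using (Injective)
open import Relation.Binary.PropositionalEquality using (_≡_; _≢_)
open import Relation.Nullary using (¬_)

Mat : ℕ → ℕ → Set
Mat m n = Fin m → Fin n → ℤ

sumℤ : ∀ {k} → (Fin k → ℤ) → ℤ
sumℤ {k} f = foldr ℤ._+_ (+ 0) (map f (allFin k))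

sumℚ : ∀ {k} → (Fin k → ℚ) → ℚ
sumℚ {k} f = foldr ℚ._+_ 0ℚ (map f (allFin k))

_⊗_ : ∀ {m k n} → Mat m k → Mat k n → Mat m n
(A ⊗ B) i j = sumℤ (λ l → A i l ℤ.* B l j)

Id : ∀ {n} → Mat n n
Id {n} i j with i Data.Fin.≟ j
... | Relation.Nullary.yes _ = + 1
... | Relation.Nullary.no _  = + 0

sgn : ℕ → ℤ
sgn zero = + 1
sgn (suc k) = ℤ.- sgn k

det : ∀ {n} → Mat n n → ℤ
det {zero}  A = + 1
det {suc n} A = sumℤ (λ j → sgn (toℕ j) ℤ.* (A zero j ℤ.* det (λ r c → A (suc r) (punchIn j c))))

IsUnimodularValue : ℤ → Set
IsUnimodularValue d = d ≡ ℤ.- (+ 1) ⊎ d ≡ + 0 ⊎ d ≡ + 1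

submatrix : ∀ {m n k} → Mat m n → (Fin k → Fin m) → (Fin k → Fin n) → Mat k k
submatrix A r c i j = A (r i) (c j)

TotallyUnimodular : ∀ {m n} → Mat m n → Set
TotallyUnimodular {m} {n} A =
  ∀ (k : ℕ) (r : Fin k → Fin m) (c : Fin k → Fin n) →
  Injective _≡_ _≡_ r → Injective _≡_ _≡_ c →
  IsUnimodularValue (det (submatrix A r c))

-- Polytopes P = conv(rows of M) ⊂ ℚ^n, M : Mat m n.

toℚ : ℤ → ℚ
toℚ z = z ℚ./ 1

pair : ∀ {m n} → Mat m n → (Fin n → ℚ) → Fin m → ℚ
pair M u i = sumℚ (λ j → u j ℚ.* toℚ (M i j))

InConv : ∀ {m n} → Mat m n → (Fin n → ℚ) → Set
InConv {m} {n} M x =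
  Σ (Fin m → ℚ) λ λs →
    (∀ i → 0ℚ ℚ.≤ λs i) × (sumℚ λs ≡ 1ℚ) ×
    (∀ j → sumℚ (λ i → λs i ℚ.* toℚ (M i j)) ≡ x j)

OriginInInterior : ∀ {m n} → Mat m n → Set
OriginInInterior {m} {n} M =
  Σ ℚ λ ε → (0ℚ ℚ.< ε) × (∀ (x : Fin n → ℚ) → (∀ j → ℚ.∣ x j ∣ ℚ.≤ ε) → InConv M x)

IsFace : ∀ {m n} → Mat m n → Subset m → Set
IsFace {m} {n} M S =
  Σ (Fin n → ℚ) λ u → Σ ℚ λ c →
    (∀ i → pair M u i ℚ.≤ c) ×
    (∀ i → (i ∈ S → pair M u i ≡ c) × (pair M u i ≡ c → i ∈ S))

IsProperFace : ∀ {m n} → Mat m n → Subset m → Set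
IsProperFace {m} M S = IsFace M S × (∃ λ (i : Fin m) → i ∈ S) × (∃ λ (i : Fin m) → i ∉ S)

IsFacet : ∀ {m n} → Mat m n → Subset m → Set
IsFacet M S = IsProperFace M S × (∀ T → IsProperFace M T → S ⊆ T → T ≡ S)

RowsAreVertices : ∀ {m n} → Mat m n → Set
RowsAreVertices {m} {n} M =
  ∀ (i : Fin m) → Σ (Fin n → ℚ) λ u → Σ ℚ λ c →
    (∀ k → pair M u k ℚ.≤ c) × (pair M u i ≡ c) × (∀ k → pair M u k ≡ c → k ≡ i)

Enumerates : ∀ {m k} → (Fin k → Fin m) → Subset m → Set
Enumerates {m} {k} f S =
  Injective _≡_ _≡_ f × (∀ i → (i ∈ S → ∃ λ l → f l ≡ i) × ((∃ λ l → f l ≡ i) → i ∈ S))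

rowsOf : ∀ {m n k} → Mat m n → (Fin k → Fin m) → Mat k n
rowsOf M f i j = M (f i) j

-- M is the coordinate matrix (rows = vertices, each vertex listed once)
-- of an n-dimensional smooth Fano polytope P = conv(rows of M).
-- (Rows are primitive automatically once every facet is a lattice basis.)
IsPrimitive : ∀ {n} → (Fin n → ℤ) → Set
IsPrimitive {n} v = ∀ (d : ℕ) (w : Fin n → ℤ) → (∀ j → v j ≡ (+ d) ℤ.* w j) → d ≡ 1

IsSmoothFanoCoordMatrix : ∀ {m n} → Mat m n → Set
IsSmoothFanoCoordMatrix {m} {n} M =
  OriginInInterior M × RowsAreVertices M × (∀ i → IsPrimitive (M i)) ×
  (∀ S → IsFacet M S →
     Σ (Fin n → Fin m) λ f → Enumerates f S ×
       (det (rowsOf M f) ≡ + 1 ⊎ det (rowsOf M f) ≡ ℤ.- (+ 1)))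

IsUnimodularPolytope : ∀ {m n} → Mat m n → Set
IsUnimodularPolytope {m} {n} M =
  ∀ (r : Fin n → Fin m) → Injective _≡_ _≡_ r → IsUnimodularValue (det (rowsOf M r))

-- Since N⁻¹ N = I, also N N⁻¹ = I, so the rows of M N⁻¹ indexed by the facet are
-- the unit vectors e_t.  A maximal minor of M N⁻¹ is det (M_R) · det N⁻¹ · (±1),
-- and det N⁻¹ = ±1, so it lies in {-1, 0, 1} by unimodularity of P.  A smaller
-- square submatrix either contains a facet row e_t vanishing on its columns, or
-- can be bordered by such a row and the missing column t without changing its
-- determinant, until it is maximal.  The determinant is defined by Laplace
-- expansion; its multiplicativity comes from the uniqueness of alternating
-- multilinear forms.
module Submission where

open import Defs
open import Data.Nat as ℕ using (ℕ; zero; suc)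
import Data.Nat.Properties as ℕP
open import Data.Fin as Fin using (Fin; zero; suc; punchIn; toℕ; inject₁)
open import Data.Fin.Properties
  using (_≟_; suc-injective; punchInᵢ≢i; punchIn-punchOut; punchIn-injective; toℕ-inject₁; pigeonhole; any?; ¬∀⟶∃¬; <⇒≢)
open import Data.Fin.Subset using (Subset)
open import Data.Integer as ℤ using (ℤ; +_; -[1+_]; _+_; _*_; -_; ∣_∣)
import Data.Integer.Properties as ℤP
open import Algebra.Bundles using (AbelianGroup)
open import Algebra.Properties.Group (AbelianGroup.group ℤP.+-0-abelianGroup) using (inverseʳ-unique)
open import Data.Integer.Tactic.RingSolver using (solve)
open import Algebra.Properties.Semiring.Sum ℤP.+-*-semiring
  using (sum; sum-cong-≗; sum-replicate-zero; sum-remove; ∑-distrib-+; ∑-comm; *-distribˡ-sum; *-distribʳ-sum)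
import Data.List as List
open import Data.List using (_∷_; [])
import Data.Vec.Functional as V
open import Data.Vec.Functional using (removeAt; insertAt; updateAt)
open import Data.Vec.Functional.Properties
  using (updateAt-updates; updateAt-minimal; updateAt-updateAt; updateAt-id-local; map-updateAt; insertAt-lookup; insertAt-punchIn)
open import Data.Product using (∃; _,_; proj₁; proj₂)
open import Data.Sum using (inj₁; inj₂)
open import Data.Empty using (⊥-elim)
open import Function using (_∘_)
open import Function.Definitions using (Injective)
open import Relation.Binary.PropositionalEquality
open import Relation.Nullary using (¬_; Dec; yes; no)

open ≡-Reasoning

sum-tabulate : ∀ {k m} (g : Fin k → Fin m) (f : Fin m → ℤ) →
  List.foldr _+_ (+ 0) (List.map f (List.tabulate g)) ≡ sum (f ∘ g)
sum-tabulate {zero}  g f = refl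
sum-tabulate {suc k} g f = cong (_+_ (f (g zero))) (sum-tabulate (g ∘ suc) f)

sumℤ≡sum : ∀ {k} (f : Fin k → ℤ) → sumℤ f ≡ sum f
sumℤ≡sum f = sum-tabulate (λ i → i) f

sum-zero : ∀ {k} (f : Fin k → ℤ) → (∀ i → f i ≡ + 0) → sum f ≡ + 0
sum-zero {k} f f≗0 = trans (sum-cong-≗ f≗0) (sum-replicate-zero k)

sum-single : ∀ {k} (f : Fin k → ℤ) j → (∀ i → i ≢ j → f i ≡ + 0) → sum f ≡ f j
sum-single {suc k} f j f≗0 = begin
  sum f                    ≡⟨ sum-remove f ⟩
  f j + sum (removeAt f j) ≡⟨ cong (_+_ (f j)) (sum-zero _ (λ i → f≗0 (punchIn j i) (punchInᵢ≢i j i))) ⟩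
  f j + + 0                ≡⟨ ℤP.+-identityʳ (f j) ⟩
  f j                      ∎

sum-linear : ∀ {k} x y (f g : Fin k → ℤ) →
  sum (λ i → x * f i + y * g i) ≡ x * sum f + y * sum g
sum-linear x y f g = begin
  sum (λ i → x * f i + y * g i)             ≡⟨ ∑-distrib-+ (λ i → x * f i) (λ i → y * g i) ⟩
  sum (λ i → x * f i) + sum (λ i → y * g i) ≡⟨ cong₂ _+_ (*-distribˡ-sum x f) (*-distribˡ-sum y g) ⟨
  x * sum f + y * sum g                     ∎

infix 4 _≈_
_≈_ : ∀ {k w} → Mat k w → Mat k w → Set
A ≈ B = ∀ i j → A i j ≡ B i j

Id-diag : ∀ {n} (i : Fin n) → Id i i ≡ + 1
Id-diag i with i ≟ i
... | yes _  = refl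
... | no i≢i = ⊥-elim (i≢i refl)

Id-off : ∀ {n} {i j : Fin n} → i ≢ j → Id i j ≡ + 0
Id-off {i = i} {j} i≢j with i ≟ j
... | yes i≡j = ⊥-elim (i≢j i≡j)
... | no _    = refl

Id-sym : ∀ {n} (i j : Fin n) → Id i j ≡ Id j i
Id-sym i j = by-cases (i ≟ j)
  where
  by-cases : Dec (i ≡ j) → Id i j ≡ Id j i
  by-cases (yes refl) = refl
  by-cases (no i≢j)   = trans (Id-off i≢j) (sym (Id-off (i≢j ∘ sym)))

Id-injective : ∀ {k n} {c : Fin k → Fin n} → Injective _≡_ _≡_ c → ∀ i j → Id (c i) (c j) ≡ Id i j
Id-injective {c = c} c-inj i j = by-cases (i ≟ j)
  where
  by-cases : Dec (i ≡ j) → Id (c i) (c j) ≡ Id i j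
  by-cases (yes refl) = trans (Id-diag (c i)) (sym (Id-diag i))
  by-cases (no i≢j)   = trans (Id-off (i≢j ∘ c-inj)) (sym (Id-off i≢j))

sum-*-Id : ∀ {n} (v : Fin n → ℤ) c → sum (λ l → v l * Id l c) ≡ v c
sum-*-Id v c = begin
  sum (λ l → v l * Id l c) ≡⟨ sum-single _ c (λ l l≢c → trans (cong (v l *_) (Id-off l≢c)) (ℤP.*-zeroʳ (v l))) ⟩
  v c * Id c c             ≡⟨ trans (cong (v c *_) (Id-diag c)) (ℤP.*-identityʳ (v c)) ⟩
  v c                      ∎

⊗-sum : ∀ {m k n} (A : Mat m k) (B : Mat k n) i j → (A ⊗ B) i j ≡ sum (λ l → A i l * B l j)
⊗-sum A B i j = sumℤ≡sum (λ l → A i l * B l j)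

⊗-identityˡ : ∀ {m n} (A : Mat m n) → Id ⊗ A ≈ A
⊗-identityˡ A i j = begin
  (Id ⊗ A) i j             ≡⟨ ⊗-sum Id A i j ⟩
  sum (λ l → Id i l * A l j) ≡⟨ sum-cong-≗ (λ l → trans (ℤP.*-comm (Id i l) (A l j)) (cong (A l j *_) (Id-sym i l))) ⟩
  sum (λ l → A l j * Id l i) ≡⟨ sum-*-Id (λ l → A l j) i ⟩
  A i j                    ∎

⊗-identityʳ : ∀ {m n} (A : Mat m n) → A ⊗ Id ≈ A
⊗-identityʳ A i j = trans (⊗-sum A Id i j) (sum-*-Id (A i) j)

⊗-congʳ : ∀ {m k n} (A : Mat m k) {B B′ : Mat k n} → B ≈ B′ → A ⊗ B ≈ A ⊗ B′
⊗-congʳ A {B} {B′} B≈B′ i j = begin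
  (A ⊗ B) i j                 ≡⟨ ⊗-sum A B i j ⟩
  sum (λ l → A i l * B l j)   ≡⟨ sum-cong-≗ (λ l → cong (A i l *_) (B≈B′ l j)) ⟩
  sum (λ l → A i l * B′ l j)  ≡⟨ ⊗-sum A B′ i j ⟨
  (A ⊗ B′) i j                ∎

⊗-assoc : ∀ {a b c d} (A : Mat a b) (B : Mat b c) (C : Mat c d) → (A ⊗ B) ⊗ C ≈ A ⊗ (B ⊗ C)
⊗-assoc A B C i j = begin
  ((A ⊗ B) ⊗ C) i j                                   ≡⟨ ⊗-sum (A ⊗ B) C i j ⟩
  sum (λ l → (A ⊗ B) i l * C l j)                     ≡⟨ sum-cong-≗ (λ l → cong (_* C l j) (⊗-sum A B i l)) ⟩
  sum (λ l → sum (λ t → A i t * B t l) * C l j)       ≡⟨ sum-cong-≗ (λ l → *-distribʳ-sum (C l j) (λ t → A i t * B t l)) ⟩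
  sum (λ l → sum (λ t → A i t * B t l * C l j))       ≡⟨ ∑-comm (λ l t → A i t * B t l * C l j) ⟩
  sum (λ t → sum (λ l → A i t * B t l * C l j))       ≡⟨ sum-cong-≗ (λ t → sum-cong-≗ (λ l → ℤP.*-assoc (A i t) (B t l) (C l j))) ⟩
  sum (λ t → sum (λ l → A i t * (B t l * C l j)))     ≡⟨ sum-cong-≗ (λ t → *-distribˡ-sum (A i t) (λ l → B t l * C l j)) ⟨
  sum (λ t → A i t * sum (λ l → B t l * C l j))       ≡⟨ sum-cong-≗ (λ t → cong (A i t *_) (⊗-sum B C t j)) ⟨
  sum (λ t → A i t * (B ⊗ C) t j)                     ≡⟨ ⊗-sum A (B ⊗ C) i j ⟨
  (A ⊗ (B ⊗ C)) i j                                   ∎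

rowMul : ∀ {k n} → (Fin k → ℤ) → Mat k n → Fin n → ℤ
rowMul u B c = sum (λ l → u l * B l c)

infixl 6 _[_]≔_
_[_]≔_ : ∀ {k w} → Mat k w → Fin k → (Fin w → ℤ) → Mat k w
A [ i ]≔ u = updateAt A i (λ _ → u)

[]≔-updates : ∀ {k w} (A : Mat k w) i (u : Fin w → ℤ) c → (A [ i ]≔ u) i c ≡ u c
[]≔-updates A i u = cong-app (updateAt-updates i A)

[]≔-minimal : ∀ {k w} (A : Mat k w) {i r} (u : Fin w → ℤ) → r ≢ i → ∀ c → (A [ i ]≔ u) r c ≡ A r c
[]≔-minimal A {i} {r} u r≢i = cong-app (updateAt-minimal r i A r≢i)

[]≔-idem : ∀ {k w} (A : Mat k w) i (u v : Fin w → ℤ) → A [ i ]≔ u [ i ]≔ v ≈ A [ i ]≔ v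
[]≔-idem A i u v r = cong-app (updateAt-updateAt i A r)

[]≔-self : ∀ {k w} (A : Mat k w) i → A [ i ]≔ A i ≈ A
[]≔-self A i r = cong-app (updateAt-id-local i A refl r)

-- Multilinear and alternating forms

record IsLinear {w w′} (φ : (Fin w → ℤ) → Fin w′ → ℤ) : Set where
  field
    ≗-cong : ∀ {u v} → (∀ c → u c ≡ v c) → ∀ c → φ u c ≡ φ v c
    linear : ∀ x y u v c → φ (λ t → x * u t + y * v t) c ≡ x * φ u c + y * φ v c

record IsMultilinear {k w} (D : Mat k w → ℤ) : Set where
  field
    ≈-cong     : ∀ {A B} → A ≈ B → D A ≡ D B
    row-linear : ∀ A i x y u v → (∀ c → A i c ≡ x * u c + y * v c) →
                 D A ≡ x * D (A [ i ]≔ u) + y * D (A [ i ]≔ v)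

record IsAlternating {k w} (D : Mat k w → ℤ) : Set where
  field
    isMultilinear : IsMultilinear D
    alternating   : ∀ A {i j} → i ≢ j → (∀ c → A i c ≡ A j c) → D A ≡ + 0

  open IsMultilinear isMultilinear public

module Multilinear {k w} {D : Mat k w → ℤ} (isMultilinear : IsMultilinear D) where
  open IsMultilinear isMultilinear public

  -- Both sides of row-linear with coefficients + 0 reduce to + 0.
  zero-row : ∀ A i → (∀ c → A i c ≡ + 0) → D A ≡ + 0
  zero-row A i Aᵢ≡0 = row-linear A i (+ 0) (+ 0) (A i) (A i) Aᵢ≡0

  linear-sum : ∀ {p} A i (a : Fin p → ℤ) (U : Fin p → Fin w → ℤ) →
    (∀ c → A i c ≡ sum (λ t → a t * U t c)) → D A ≡ sum (λ t → a t * D (A [ i ]≔ U t))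
  linear-sum {zero}  A i a U Aᵢ≡∑ = zero-row A i Aᵢ≡∑
  linear-sum {suc p} A i a U Aᵢ≡∑ = begin
    D A
      ≡⟨ row-linear A i (a zero) (+ 1) (U zero) R (λ c → trans (Aᵢ≡∑ c) (cong (_+_ (a zero * U zero c)) (sym (ℤP.*-identityˡ (R c))))) ⟩
    first + + 1 * D (A [ i ]≔ R)
      ≡⟨ cong (_+_ first) (ℤP.*-identityˡ _) ⟩
    first + D (A [ i ]≔ R)
      ≡⟨ cong (_+_ first) (linear-sum (A [ i ]≔ R) i (a ∘ suc) (U ∘ suc) ([]≔-updates A i R)) ⟩
    first + sum (λ t → a (suc t) * D (A [ i ]≔ R [ i ]≔ U (suc t)))
      ≡⟨ cong (_+_ first) (sum-cong-≗ (λ t → cong (a (suc t) *_) (≈-cong ([]≔-idem A i R (U (suc t)))))) ⟩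
    sum (λ t → a t * D (A [ i ]≔ U t)) ∎
    where
    R : Fin w → ℤ
    R c = sum (λ t → a (suc t) * U (suc t) c)
    first : ℤ
    first = a zero * D (A [ i ]≔ U zero)

  expand-row : ∀ A i → D A ≡ sum (λ j → A i j * D (A [ i ]≔ Id j))
  expand-row A i = linear-sum A i (A i) Id (λ c → sym (sum-*-Id (A i) c))

module Alternating {k w} {D : Mat k w → ℤ} (isAlternating : IsAlternating D) where
  open IsAlternating isAlternating using (isMultilinear; alternating) public
  open Multilinear isMultilinear public

  -- Writing β u v for D with rows i, j set to u, v: β is bilinear with β u u = 0,
  -- so 0 = β (u + v) (u + v) = β u v + β v u.
  swap-rows : ∀ A A′ {i j} → i ≢ j → (∀ r → r ≢ i → r ≢ j → ∀ c → A′ r c ≡ A r c) →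
    (∀ c → A′ i c ≡ A j c) → (∀ c → A′ j c ≡ A i c) → D A′ ≡ - D A
  swap-rows A A′ {i} {j} i≢j A′≡A A′ᵢ≡Aⱼ A′ⱼ≡Aᵢ = begin
    D A′                            ≡⟨ ≈-cong (≈-T A′ A′ᵢ≡Aⱼ A′ⱼ≡Aᵢ A′≡A) ⟩
    β (A j) (A i)                   ≡⟨ inverseʳ-unique (β (A i) (A j)) (β (A j) (A i)) antisym ⟩
    - β (A i) (A j)                 ≡⟨ cong -_ (≈-cong (≈-T A (λ _ → refl) (λ _ → refl) (λ _ _ _ _ → refl))) ⟨
    - D A                           ∎
    where
    T : (Fin w → ℤ) → (Fin w → ℤ) → Mat k w
    T u v = A [ i ]≔ u [ j ]≔ v

    β : (Fin w → ℤ) → (Fin w → ℤ) → ℤ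
    β u v = D (T u v)

    j≢i : j ≢ i
    j≢i = i≢j ∘ sym

    T-i : ∀ u v c → T u v i c ≡ u c
    T-i u v c = trans ([]≔-minimal _ v i≢j c) ([]≔-updates A i u c)

    T-other : ∀ u v {r} → r ≢ i → r ≢ j → ∀ c → T u v r c ≡ A r c
    T-other u v r≢i r≢j c = trans ([]≔-minimal _ v r≢j c) ([]≔-minimal A u r≢i c)

    ≈-T : ∀ B {u v} → (∀ c → B i c ≡ u c) → (∀ c → B j c ≡ v c) →
          (∀ r → r ≢ i → r ≢ j → ∀ c → B r c ≡ A r c) → B ≈ T u v
    ≈-T B {u} {v} Bᵢ Bⱼ Bᵣ r c with r ≟ i | r ≟ j
    ... | yes refl | _        = trans (Bᵢ c) (sym (T-i u v c))
    ... | no _     | yes refl = trans (Bⱼ c) (sym ([]≔-updates _ j v c))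
    ... | no r≢i   | no r≢j   = trans (Bᵣ r r≢i r≢j c) (sym (T-other u v r≢i r≢j c))

    sum-as-combination : ∀ (u v : Fin w → ℤ) c → u c + v c ≡ + 1 * u c + + 1 * v c
    sum-as-combination u v c = sym (cong₂ _+_ (ℤP.*-identityˡ (u c)) (ℤP.*-identityˡ (v c)))

    additive : ∀ x y → + 1 * x + + 1 * y ≡ x + y
    additive x y = cong₂ _+_ (ℤP.*-identityˡ x) (ℤP.*-identityˡ y)

    β-+ˡ : ∀ u v z → β (λ c → u c + v c) z ≡ β u z + β v z
    β-+ˡ u v z = trans
      (row-linear (T s z) i (+ 1) (+ 1) u v (λ c → trans (T-i s z c) (sum-as-combination u v c)))
      (trans (cong₂ (λ p q → + 1 * p + + 1 * q) (≈-cong (replace u)) (≈-cong (replace v))) (additive (β u z) (β v z)))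
      where
      s : Fin w → ℤ
      s c = u c + v c
      replace : ∀ y → T s z [ i ]≔ y ≈ T y z
      replace y = ≈-T _ ([]≔-updates _ i y)
        (λ c → trans ([]≔-minimal _ y j≢i c) ([]≔-updates _ j z c))
        (λ r r≢i r≢j c → trans ([]≔-minimal _ y r≢i c) (T-other s z r≢i r≢j c))

    β-+ʳ : ∀ z u v → β z (λ c → u c + v c) ≡ β z u + β z v
    β-+ʳ z u v = trans
      (row-linear (T z s) j (+ 1) (+ 1) u v (λ c → trans ([]≔-updates _ j s c) (sum-as-combination u v c)))
      (trans (cong₂ (λ p q → + 1 * p + + 1 * q) (≈-cong ([]≔-idem _ j s u)) (≈-cong ([]≔-idem _ j s v))) (additive (β z u) (β z v)))
      where
      s : Fin w → ℤ
      s c = u c + v c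

    β-diag : ∀ u → β u u ≡ + 0
    β-diag u = alternating (T u u) i≢j (λ c → trans (T-i u u c) (sym ([]≔-updates _ j u c)))

    antisym : β (A i) (A j) + β (A j) (A i) ≡ + 0
    antisym = begin
      β u v + β v u                       ≡⟨ cong₂ _+_ (ℤP.+-identityˡ (β u v)) (ℤP.+-identityʳ (β v u)) ⟨
      (+ 0 + β u v) + (β v u + + 0)       ≡⟨ cong₂ (λ p q → (p + β u v) + (β v u + q)) (β-diag u) (β-diag v) ⟨
      (β u u + β u v) + (β v u + β v v)   ≡⟨ cong₂ _+_ (β-+ʳ u u v) (β-+ʳ v u v) ⟨
      β u (u ⊕ v) + β v (u ⊕ v)           ≡⟨ β-+ˡ u v (u ⊕ v) ⟨
      β (u ⊕ v) (u ⊕ v)                   ≡⟨ β-diag (u ⊕ v) ⟩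
      + 0                                 ∎
      where
      u v : Fin w → ℤ
      u = A i
      v = A j
      _⊕_ : (Fin w → ℤ) → (Fin w → ℤ) → Fin w → ℤ
      (u ⊕ v) c = u c + v c

∷-isMultilinear : ∀ {k w} {D : Mat (suc k) w → ℤ} → IsMultilinear D →
  ∀ u → IsMultilinear (λ (B : Mat k w) → D (u V.∷ B))
∷-isMultilinear {D = D} isMultilinear u = record
  { ≈-cong     = λ B≈C → ≈-cong (λ { zero c → refl ; (suc r) c → B≈C r c })
  ; row-linear = λ B i x y v v′ Bᵢ → trans (row-linear (u V.∷ B) (suc i) x y v v′ Bᵢ)
      (cong₂ (λ p q → x * p + y * q) (≈-cong (λ { zero c → refl ; (suc r) c → refl }))
                                     (≈-cong (λ { zero c → refl ; (suc r) c → refl })))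
  }
  where open IsMultilinear isMultilinear

∷-isAlternating : ∀ {k w} {D : Mat (suc k) w → ℤ} → IsAlternating D →
  ∀ u → IsAlternating (λ (B : Mat k w) → D (u V.∷ B))
∷-isAlternating isAlternating u = record
  { isMultilinear = ∷-isMultilinear isMultilinear u
  ; alternating   = λ B i≢j Bᵢ≡Bⱼ → alternating (u V.∷ B) (i≢j ∘ suc-injective) Bᵢ≡Bⱼ
  }
  where open IsAlternating isAlternating

map-isMultilinear : ∀ {k w w′} {D : Mat k w′ → ℤ} {φ : (Fin w → ℤ) → Fin w′ → ℤ} →
  IsMultilinear D → IsLinear φ → IsMultilinear (λ (B : Mat k w) → D (φ ∘ B))
map-isMultilinear {D = D} {φ} isMultilinear φ-linear = record
  { ≈-cong     = λ B≈C → ≈-cong (λ r → ≗-cong (B≈C r))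
  ; row-linear = λ B i x y u v Bᵢ → trans
      (row-linear (φ ∘ B) i x y (φ u) (φ v) (λ c → trans (≗-cong Bᵢ c) (linear x y u v c)))
      (cong₂ (λ p q → x * p + y * q) (≈-cong (map-[]≔ B i u)) (≈-cong (map-[]≔ B i v)))
  }
  where
  open IsMultilinear isMultilinear
  open IsLinear φ-linear
  map-[]≔ : ∀ B i u → (φ ∘ B) [ i ]≔ φ u ≈ φ ∘ (B [ i ]≔ u)
  map-[]≔ B i u r = cong-app (sym (map-updateAt {f = φ} (λ _ → refl) B i r))

map-isAlternating : ∀ {k w w′} {D : Mat k w′ → ℤ} {φ : (Fin w → ℤ) → Fin w′ → ℤ} →
  IsAlternating D → IsLinear φ → IsAlternating (λ (B : Mat k w) → D (φ ∘ B))
map-isAlternating isAlternating φ-linear = record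
  { isMultilinear = map-isMultilinear isMultilinear φ-linear
  ; alternating   = λ B i≢j Bᵢ≡Bⱼ → alternating _ i≢j (IsLinear.≗-cong φ-linear Bᵢ≡Bⱼ)
  }
  where open IsAlternating isAlternating

-- The determinant

sign : ∀ {n} → Fin n → ℤ
sign j = sgn (toℕ j)

minor : ∀ {n w} → Mat (suc n) (suc w) → Fin (suc w) → Mat n w
minor A j r = removeAt (A (suc r)) j

det-expand : ∀ {n} (A : Mat (suc n) (suc n)) → det A ≡ sum (λ j → sign j * (A zero j * det (minor A j)))
det-expand A = sumℤ≡sum (λ j → sign j * (A zero j * det (minor A j)))

det-cong : ∀ {n} {A B : Mat n n} → A ≈ B → det A ≡ det B
det-cong {zero}          _   = refl
det-cong {suc n} {A} {B} A≈B = begin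
  det A                                             ≡⟨ det-expand A ⟩
  sum (λ j → sign j * (A zero j * det (minor A j))) ≡⟨ sum-cong-≗ (λ j → cong₂ (λ a d → sign j * (a * d))
                                                         (A≈B zero j) (det-cong (λ r c → A≈B (suc r) (punchIn j c)))) ⟩
  sum (λ j → sign j * (B zero j * det (minor B j))) ≡⟨ det-expand B ⟨
  det B                                             ∎

minor-[]≔ : ∀ {n} (A : Mat (suc n) (suc n)) i u j → minor (A [ suc i ]≔ u) j ≈ minor A j [ i ]≔ removeAt u j
minor-[]≔ A i u j r = cong-app (map-updateAt {f = λ v → removeAt v j} (λ _ → refl) (λ r → A (suc r)) i r)

det-row-linear : ∀ {n} (A : Mat n n) i x y u v → (∀ c → A i c ≡ x * u c + y * v c) →
  det A ≡ x * det (A [ i ]≔ u) + y * det (A [ i ]≔ v)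
det-row-linear {suc n} A zero x y u v A₀ = begin
  det A                                                 ≡⟨ det-expand A ⟩
  sum (λ j → sign j * (A zero j * d j))                 ≡⟨ sum-cong-≗ (λ j → cong (λ a → sign j * (a * d j)) (A₀ j)) ⟩
  sum (λ j → sign j * ((x * u j + y * v j) * d j))      ≡⟨ sum-cong-≗ (λ j → distrib (sign j) (u j) (v j) (d j)) ⟩
  sum (λ j → x * (sign j * (u j * d j)) + y * (sign j * (v j * d j)))
                                                        ≡⟨ sum-linear x y (λ j → sign j * (u j * d j)) (λ j → sign j * (v j * d j)) ⟩
  x * sum (λ j → sign j * (u j * d j)) + y * sum (λ j → sign j * (v j * d j))
                                                        ≡⟨ cong₂ (λ p q → x * p + y * q) (det-expand (A [ zero ]≔ u)) (det-expand (A [ zero ]≔ v)) ⟨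
  x * det (A [ zero ]≔ u) + y * det (A [ zero ]≔ v)     ∎
  where
  d : Fin (suc n) → ℤ
  d j = det (minor A j)
  distrib : ∀ s a b e → s * ((x * a + y * b) * e) ≡ x * (s * (a * e)) + y * (s * (b * e))
  distrib s a b e = solve (s ∷ a ∷ b ∷ e ∷ x ∷ y ∷ [])
det-row-linear {suc n} A (suc i) x y u v Aᵢ = begin
  det A                                                  ≡⟨ det-expand A ⟩
  sum (λ j → sign j * (A zero j * det (minor A j)))      ≡⟨ sum-cong-≗ (λ j → cong (λ e → sign j * (A zero j * e)) (minor-linear j)) ⟩
  sum (λ j → sign j * (A zero j * (x * du j + y * dv j))) ≡⟨ sum-cong-≗ (λ j → distrib (sign j) (A zero j) (du j) (dv j)) ⟩
  sum (λ j → x * (sign j * (A zero j * du j)) + y * (sign j * (A zero j * dv j)))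
                                                         ≡⟨ sum-linear x y (λ j → sign j * (A zero j * du j)) (λ j → sign j * (A zero j * dv j)) ⟩
  x * sum (λ j → sign j * (A zero j * du j)) + y * sum (λ j → sign j * (A zero j * dv j))
                                                         ≡⟨ cong₂ (λ p q → x * p + y * q) (det-expand (A [ suc i ]≔ u)) (det-expand (A [ suc i ]≔ v)) ⟨
  x * det (A [ suc i ]≔ u) + y * det (A [ suc i ]≔ v)    ∎
  where
  du dv : Fin (suc n) → ℤ
  du j = det (minor (A [ suc i ]≔ u) j)
  dv j = det (minor (A [ suc i ]≔ v) j)
  minor-linear : ∀ j → det (minor A j) ≡ x * du j + y * dv j
  minor-linear j = trans (det-row-linear (minor A j) i x y (removeAt u j) (removeAt v j) (Aᵢ ∘ punchIn j))
    (sym (cong₂ (λ p q → x * p + y * q) (det-cong (minor-[]≔ A i u j)) (det-cong (minor-[]≔ A i v j))))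
  distrib : ∀ s a e e′ → s * (a * (x * e + y * e′)) ≡ x * (s * (a * e)) + y * (s * (a * e′))
  distrib s a e e′ = solve (s ∷ a ∷ e ∷ e′ ∷ x ∷ y ∷ [])

det-isMultilinear : ∀ {n} → IsMultilinear (det {n})
det-isMultilinear = record { ≈-cong = det-cong ; row-linear = det-row-linear }

det-firstRow-diagonal : ∀ {n} (A : Mat (suc n) (suc n)) → (∀ c → A zero (suc c) ≡ + 0) →
  det A ≡ A zero zero * det (minor A zero)
det-firstRow-diagonal A A₀≡0 = begin
  det A                                             ≡⟨ det-expand A ⟩
  sum (λ j → sign j * (A zero j * det (minor A j))) ≡⟨ sum-single _ zero off-diagonal ⟩
  + 1 * (A zero zero * det (minor A zero))          ≡⟨ ℤP.*-identityˡ (A zero zero * det (minor A zero)) ⟩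
  A zero zero * det (minor A zero)                  ∎
  where
  off-diagonal : ∀ j → j ≢ zero → sign j * (A zero j * det (minor A j)) ≡ + 0
  off-diagonal zero    0≢0 = ⊥-elim (0≢0 refl)
  off-diagonal (suc c) _   = trans (cong (λ a → sign (suc c) * (a * det (minor A (suc c)))) (A₀≡0 c)) (ℤP.*-zeroʳ (sign (suc c)))

det-Id : ∀ {n} → det (Id {n}) ≡ + 1
det-Id {zero}  = refl
det-Id {suc n} = begin
  det (Id {suc n})                    ≡⟨ det-firstRow-diagonal (Id {suc n}) (λ c → Id-off {i = zero} {suc c} (λ ())) ⟩
  Id {suc n} zero zero * det (minor (Id {suc n}) zero)  ≡⟨ cong₂ _*_ (Id-diag {suc n} zero) (det-cong minor-Id) ⟩
  + 1 * det (Id {n})                  ≡⟨ cong (+ 1 *_) (det-Id {n}) ⟩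
  + 1                                 ∎
  where
  minor-Id : minor (Id {suc n}) zero ≈ Id
  minor-Id = Id-injective suc-injective

sum-neg : ∀ {k} (f : Fin k → ℤ) → sum (λ i → - f i) ≡ - sum f
sum-neg {zero}  f = refl
sum-neg {suc k} f = trans (cong (_+_ (- f zero)) (sum-neg (f ∘ suc))) (sym (ℤP.neg-distrib-+ (f zero) (sum (f ∘ suc))))

-- Expanding det A along its first two rows, both equal to a, where K φ is the
-- determinant of the remaining rows restricted to the columns φ.
laplace² : ∀ {m} → (Fin (suc (suc m)) → ℤ) → ((Fin m → Fin (suc (suc m))) → ℤ) → ℤ
laplace² a K = sum (λ j → sign j * (a j * sum (λ l → sign l * (a (punchIn j l) * K (punchIn j ∘ punchIn l)))))

-- The terms with j = 0 cancel those with l = 0; the remaining ones form laplace² (a ∘ suc).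
laplace²-peel : ∀ {m} a K →
  laplace² {m} a K ≡ sum (λ j → sign j * (a (suc j) * sum (λ l →
                       sign l * (a (suc (punchIn j l)) * K (punchIn (suc j) ∘ punchIn (suc l))))))
laplace²-peel a K = begin
  laplace² a K
    ≡⟨ cong₂ _+_ (ℤP.*-identityˡ (a zero * sum U)) (sum-cong-≗ peel) ⟩
  a zero * sum U + sum (λ j → - a zero * U j + X j)
    ≡⟨ cong (_+_ (a zero * sum U)) (∑-distrib-+ (λ j → - a zero * U j) X) ⟩
  a zero * sum U + (sum (λ j → - a zero * U j) + sum X)
    ≡⟨ cong (λ p → a zero * sum U + (p + sum X)) (*-distribˡ-sum (- a zero) U) ⟨
  a zero * sum U + (- a zero * sum U + sum X)
    ≡⟨ cancel (a zero) (sum U) (sum X) ⟩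
  sum X ∎
  where
  U : Fin _ → ℤ
  U j = sign j * (a (suc j) * K (suc ∘ punchIn j))
  W : Fin _ → ℤ
  W j = sum (λ l → sign l * (a (suc (punchIn j l)) * K (punchIn (suc j) ∘ punchIn (suc l))))
  X : Fin _ → ℤ
  X j = sign j * (a (suc j) * W j)
  inner : ∀ j → sum (λ l → sign (suc l) * (a (suc (punchIn j l)) * K (punchIn (suc j) ∘ punchIn (suc l)))) ≡ - W j
  inner j = trans
    (sum-cong-≗ (λ l → sym (ℤP.neg-distribˡ-* (sign l) (a (suc (punchIn j l)) * K (punchIn (suc j) ∘ punchIn (suc l))))))
    (sum-neg (λ l → sign l * (a (suc (punchIn j l)) * K (punchIn (suc j) ∘ punchIn (suc l)))))
  rearrange : ∀ s b a₀ κ w → - s * (b * (+ 1 * (a₀ * κ) + - w)) ≡ - a₀ * (s * (b * κ)) + s * (b * w)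
  rearrange s b a₀ κ w = solve (s ∷ b ∷ a₀ ∷ κ ∷ w ∷ [])
  peel : ∀ j → sign (suc j) * (a (suc j) * (+ 1 * (a zero * K (suc ∘ punchIn j)) +
                 sum (λ l → sign (suc l) * (a (suc (punchIn j l)) * K (punchIn (suc j) ∘ punchIn (suc l))))))
             ≡ - a zero * U j + X j
  peel j = trans (cong (λ t → - sign j * (a (suc j) * (+ 1 * (a zero * K (suc ∘ punchIn j)) + t))) (inner j))
                 (rearrange (sign j) (a (suc j)) (a zero) (K (suc ∘ punchIn j)) (W j))
  cancel : ∀ x s t → x * s + (- x * s + t) ≡ t
  cancel x s t = solve (x ∷ s ∷ t ∷ [])

laplace²-cancels : ∀ {m} a K → (∀ {φ ψ} → (∀ c → φ c ≡ ψ c) → K φ ≡ K ψ) → laplace² {m} a K ≡ + 0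
laplace²-cancels {zero}  a K K-cong = trans (laplace²-peel a K)
  (sum-zero _ (λ j → trans (cong (sign j *_) (ℤP.*-zeroʳ (a (suc j)))) (ℤP.*-zeroʳ (sign j))))
laplace²-cancels {suc m} a K K-cong = begin
  laplace² a K
    ≡⟨ laplace²-peel a K ⟩
  sum (λ j → sign j * (a (suc j) * sum (λ l → sign l * (a (suc (punchIn j l)) * K (punchIn (suc j) ∘ punchIn (suc l))))))
    ≡⟨ sum-cong-≗ (λ j → cong (λ t → sign j * (a (suc j) * t)) (sum-cong-≗ (λ l →
         cong (λ κ → sign l * (a (suc (punchIn j l)) * κ)) (K-cong {punchIn (suc j) ∘ punchIn (suc l)}
           {zero V.∷ (suc ∘ punchIn j ∘ punchIn l)} (λ { zero → refl ; (suc c) → refl }))))) ⟩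
  laplace² (a ∘ suc) K′
    ≡⟨ laplace²-cancels (a ∘ suc) K′ (λ φ≗ψ → K-cong (λ { zero → refl ; (suc c) → cong suc (φ≗ψ c) })) ⟩
  + 0 ∎
  where
  K′ : (Fin m → Fin (suc (suc m))) → ℤ
  K′ φ = K (zero V.∷ (suc ∘ φ))

det-rows01-equal : ∀ {m} (A : Mat (suc (suc m)) (suc (suc m))) → (∀ c → A zero c ≡ A (suc zero) c) → det A ≡ + 0
det-rows01-equal A A₀≡A₁ = begin
  det A
    ≡⟨ det-expand A ⟩
  sum (λ j → sign j * (A zero j * det (minor A j)))
    ≡⟨ sum-cong-≗ (λ j → cong (λ d → sign j * (A zero j * d)) (trans (det-expand (minor A j))
         (sum-cong-≗ (λ l → cong (λ a → sign l * (a * det (minor (minor A j) l))) (sym (A₀≡A₁ (punchIn j l))))))) ⟩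
  laplace² (A zero) K
    ≡⟨ laplace²-cancels (A zero) K (λ φ≗ψ → det-cong (λ r c → cong (A (suc (suc r))) (φ≗ψ c))) ⟩
  + 0 ∎
  where
  K : (Fin _ → Fin _) → ℤ
  K φ = det (λ r c → A (suc (suc r)) (φ c))

-- Swapping rows 1 and j + 1 of A swaps rows 0 and j of every minor along the first row.
det-rows0j-equal : ∀ {n} → IsAlternating (det {n}) →
  ∀ (A : Mat (suc n) (suc n)) j → (∀ c → A zero c ≡ A (suc j) c) → det A ≡ + 0
det-rows0j-equal {suc n} _      A zero    A₀≡A₁ = det-rows01-equal A A₀≡A₁
det-rows0j-equal {suc n} det-alt A (suc j) A₀≡Aⱼ = begin
  det A       ≡⟨ ℤP.neg-involutive (det A) ⟨
  - (- det A) ≡⟨ cong -_ det-A′ ⟨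
  - det A′    ≡⟨ cong -_ (det-rows01-equal A′ (λ c → trans (A₀≡Aⱼ c) (sym (A′₁ c)))) ⟩
  + 0         ∎
  where
  open Alternating det-alt using (swap-rows)
  A₁↦ⱼ A′ : Mat (suc (suc n)) (suc (suc n))
  A₁↦ⱼ = A [ suc zero ]≔ A (suc (suc j))
  A′ = A₁↦ⱼ [ suc (suc j) ]≔ A (suc zero)
  A′₁ : ∀ c → A′ (suc zero) c ≡ A (suc (suc j)) c
  A′₁ c = refl
  minor-swapped : ∀ t → det (minor A′ t) ≡ - det (minor A t)
  minor-swapped t = swap-rows (minor A t) (minor A′ t) {zero} {suc j} (λ ())
    (λ r r≢0 r≢j c → trans ([]≔-minimal A₁↦ⱼ (A (suc zero)) (r≢j ∘ suc-injective) (punchIn t c))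
                            ([]≔-minimal A (A (suc (suc j))) (r≢0 ∘ suc-injective) (punchIn t c)))
    (λ c → refl)
    (λ c → []≔-updates A₁↦ⱼ (suc (suc j)) (A (suc zero)) (punchIn t c))
  det-A′ : det A′ ≡ - det A
  det-A′ = begin
    det A′                                                ≡⟨ det-expand A′ ⟩
    sum (λ t → sign t * (A zero t * det (minor A′ t)))    ≡⟨ sum-cong-≗ (λ t → trans
                                                               (cong (λ d → sign t * (A zero t * d)) (minor-swapped t))
                                                               (neg-inside (sign t) (A zero t) (det (minor A t)))) ⟩
    sum (λ t → - (sign t * (A zero t * det (minor A t)))) ≡⟨ sum-neg (λ t → sign t * (A zero t * det (minor A t))) ⟩
    - sum (λ t → sign t * (A zero t * det (minor A t)))   ≡⟨ cong -_ (det-expand A) ⟨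
    - det A                                               ∎
    where
    neg-inside : ∀ s a d → s * (a * - d) ≡ - (s * (a * d))
    neg-inside s a d = solve (s ∷ a ∷ d ∷ [])

det-isAlternating : ∀ {n} → IsAlternating (det {n})
det-alternating : ∀ {n} (A : Mat n n) {i j} → i ≢ j → (∀ c → A i c ≡ A j c) → det A ≡ + 0

det-isAlternating = record { isMultilinear = det-isMultilinear ; alternating = det-alternating }

det-alternating {suc n} A {zero}  {zero}  0≢0 _     = ⊥-elim (0≢0 refl)
det-alternating {suc n} A {zero}  {suc j} _   A₀≡Aⱼ = det-rows0j-equal det-isAlternating A j A₀≡Aⱼ
det-alternating {suc n} A {suc i} {zero}  _   Aᵢ≡A₀ = det-rows0j-equal det-isAlternating A i (sym ∘ Aᵢ≡A₀)
det-alternating {suc n} A {suc i} {suc j} i≢j Aᵢ≡Aⱼ = trans (det-expand A) (sum-zero _ (λ t → trans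
  (cong (λ d → sign t * (A zero t * d)) (det-alternating (minor A t) (i≢j ∘ cong suc) (Aᵢ≡Aⱼ ∘ punchIn t)))
  (trans (cong (sign t *_) (ℤP.*-zeroʳ (A zero t))) (ℤP.*-zeroʳ (sign t)))))

-- Uniqueness and multiplicativity of the determinant

insertAt-removeAt≗updateAt : ∀ {n} (u : Fin (suc n) → ℤ) j x c →
  insertAt (removeAt u j) j x c ≡ updateAt u j (λ _ → x) c
insertAt-removeAt≗updateAt u zero x zero = refl
insertAt-removeAt≗updateAt u zero x (suc c) = refl
insertAt-removeAt≗updateAt {suc n} u (suc j) x zero = refl
insertAt-removeAt≗updateAt {suc n} u (suc j) x (suc c) = insertAt-removeAt≗updateAt (u ∘ suc) j x c

split-at : ∀ {n} (u : Fin n → ℤ) j c → u c ≡ + 1 * updateAt u j (λ _ → + 0) c + u j * Id j c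
split-at u j c = by-cases (c ≟ j)
  where
  by-cases : Dec (c ≡ j) → u c ≡ + 1 * updateAt u j (λ _ → + 0) c + u j * Id j c
  by-cases (yes refl) = sym (begin
    + 1 * updateAt u c (λ _ → + 0) c + u c * Id c c ≡⟨ cong₂ (λ p q → + 1 * p + u c * q) (updateAt-updates c u) (Id-diag c) ⟩
    + 1 * + 0 + u c * + 1                         ≡⟨ trans (ℤP.+-identityˡ (u c * + 1)) (ℤP.*-identityʳ (u c)) ⟩
    u c                                           ∎)
  by-cases (no c≢j) = sym (begin
    + 1 * updateAt u j (λ _ → + 0) c + u j * Id j c ≡⟨ cong₂ (λ p q → + 1 * p + u j * q) (updateAt-minimal c j u c≢j) (Id-off (c≢j ∘ sym)) ⟩
    + 1 * u c + u j * + 0                          ≡⟨ cong₂ _+_ (ℤP.*-identityˡ (u c)) (ℤP.*-zeroʳ (u j)) ⟩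
    u c + + 0                                      ≡⟨ ℤP.+-identityʳ (u c) ⟩
    u c                                            ∎)

-- Each row differs from its cleared version by a multiple of e_j, on which Q vanishes.
clear-column : ∀ {k w} {Q : Mat k w → ℤ} → IsMultilinear Q → ∀ j →
  (∀ B r → (∀ c → B r c ≡ Id j c) → Q B ≡ + 0) →
  ∀ B → Q B ≡ Q (λ r → updateAt (B r) j (λ _ → + 0))
clear-column {zero}  isMultilinear j vanish B = IsMultilinear.≈-cong isMultilinear (λ ())
clear-column {suc k} {Q = Q} isMultilinear j vanish B = begin
  Q B
    ≡⟨ row-linear B zero (+ 1) (B zero j) B₀′ (Id j) (split-at (B zero) j) ⟩
  + 1 * Q (B [ zero ]≔ B₀′) + B zero j * Q (B [ zero ]≔ Id j)
    ≡⟨ cong (λ q → + 1 * Q (B [ zero ]≔ B₀′) + B zero j * q) (vanish (B [ zero ]≔ Id j) zero (λ c → refl)) ⟩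
  + 1 * Q (B [ zero ]≔ B₀′) + B zero j * + 0
    ≡⟨ cong₂ _+_ (ℤP.*-identityˡ (Q (B [ zero ]≔ B₀′))) (ℤP.*-zeroʳ (B zero j)) ⟩
  Q (B [ zero ]≔ B₀′) + + 0
    ≡⟨ ℤP.+-identityʳ (Q (B [ zero ]≔ B₀′)) ⟩
  Q (B [ zero ]≔ B₀′)
    ≡⟨ ≈-cong (λ { zero c → refl ; (suc r) c → refl }) ⟩
  Q (B₀′ V.∷ (B ∘ suc))
    ≡⟨ clear-column (∷-isMultilinear isMultilinear B₀′) j (λ F r Fᵣ → vanish (B₀′ V.∷ F) (suc r) Fᵣ) (B ∘ suc) ⟩
  Q (B₀′ V.∷ (λ r → updateAt (B (suc r)) j (λ _ → + 0)))
    ≡⟨ ≈-cong (λ { zero c → refl ; (suc r) c → refl }) ⟩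
  Q (λ r → updateAt (B r) j (λ _ → + 0)) ∎
  where
  open IsMultilinear isMultilinear
  B₀′ : _ → ℤ
  B₀′ = updateAt (B zero) j (λ _ → + 0)

insertAt-isLinear : ∀ {n} (j : Fin (suc n)) → IsLinear (λ (u : Fin n → ℤ) → insertAt u j (+ 0))
insertAt-isLinear j = record { ≗-cong = insertAt-cong j ; linear = insertAt-linear j }
  where
  insertAt-cong : ∀ {n} (j : Fin (suc n)) {u v : Fin n → ℤ} → (∀ c → u c ≡ v c) →
    ∀ c → insertAt u j (+ 0) c ≡ insertAt v j (+ 0) c
  insertAt-cong zero            u≗v zero    = refl
  insertAt-cong zero            u≗v (suc c) = u≗v c
  insertAt-cong {suc n} (suc j) u≗v zero    = u≗v zero
  insertAt-cong {suc n} (suc j) u≗v (suc c) = insertAt-cong j (u≗v ∘ suc) c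
  insertAt-linear : ∀ {n} (j : Fin (suc n)) x y (u v : Fin n → ℤ) c →
    insertAt (λ t → x * u t + y * v t) j (+ 0) c ≡ x * insertAt u j (+ 0) c + y * insertAt v j (+ 0) c
  insertAt-linear zero            x y u v zero    = sym (cong₂ _+_ (ℤP.*-zeroʳ x) (ℤP.*-zeroʳ y))
  insertAt-linear zero            x y u v (suc c) = refl
  insertAt-linear {suc n} (suc j) x y u v zero    = refl
  insertAt-linear {suc n} (suc j) x y u v (suc c) = insertAt-linear j x y (u ∘ suc) (v ∘ suc) c

insertAt-Id : ∀ {n} (j : Fin (suc n)) r c → insertAt (Id r) j (+ 0) c ≡ Id (punchIn j r) c
insertAt-Id j r c = by-cases (j ≟ c)
  where
  by-cases : Dec (j ≡ c) → insertAt (Id r) j (+ 0) c ≡ Id (punchIn j r) c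
  by-cases (yes refl) = trans (insertAt-lookup (Id r) j (+ 0)) (sym (Id-off (punchInᵢ≢i j r)))
  by-cases (no j≢c)   = begin
    insertAt (Id r) j (+ 0) c               ≡⟨ cong (insertAt (Id r) j (+ 0)) (punchIn-punchOut j≢c) ⟨
    insertAt (Id r) j (+ 0) (punchIn j c′)  ≡⟨ insertAt-punchIn (Id r) j (+ 0) c′ ⟩
    Id r c′                                 ≡⟨ Id-injective (punchIn-injective j _ _) r c′ ⟨
    Id (punchIn j r) (punchIn j c′)         ≡⟨ cong (Id (punchIn j r)) (punchIn-punchOut j≢c) ⟩
    Id (punchIn j r) c                      ∎
    where
    c′ = Fin.punchOut j≢c

punchIn-inject₁-self : ∀ {n} (i : Fin n) → punchIn (inject₁ i) i ≡ suc i
punchIn-inject₁-self zero    = refl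
punchIn-inject₁-self (suc i) = cong suc (punchIn-inject₁-self i)

punchIn-suc-self : ∀ {n} (i : Fin n) → punchIn (suc i) i ≡ inject₁ i
punchIn-suc-self zero    = refl
punchIn-suc-self (suc i) = cong suc (punchIn-suc-self i)

punchIn-suc≡punchIn-inject₁ : ∀ {n} {i r : Fin n} → r ≢ i → punchIn (suc i) r ≡ punchIn (inject₁ i) r
punchIn-suc≡punchIn-inject₁ {i = zero}  {zero}  r≢i = ⊥-elim (r≢i refl)
punchIn-suc≡punchIn-inject₁ {i = zero}  {suc r} _   = refl
punchIn-suc≡punchIn-inject₁ {i = suc i} {zero}  _   = refl
punchIn-suc≡punchIn-inject₁ {i = suc i} {suc r} r≢i = cong suc (punchIn-suc≡punchIn-inject₁ (r≢i ∘ cong suc))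

cycle : ∀ {n} → Fin (suc n) → Mat (suc n) (suc n)
cycle j = Id j V.∷ (Id ∘ punchIn j)

cycle-sign : ∀ {n} {D : Mat (suc n) (suc n) → ℤ} → IsAlternating D → ∀ j → D (cycle j) ≡ sign j * D Id
cycle-sign {n} {D} isAlternating j = go (toℕ j) j refl
  where
  open Alternating isAlternating
  go : ∀ t (j : Fin (suc n)) → toℕ j ≡ t → D (cycle j) ≡ sign j * D Id
  go _       zero    _ = trans (≈-cong (λ { zero c → refl ; (suc r) c → refl })) (sym (ℤP.*-identityˡ (D Id)))
  go (suc t) (suc j) j≡t = begin
    D (cycle (suc j))                 ≡⟨ swap-rows (cycle (inject₁ j)) (cycle (suc j)) {zero} {suc j} (λ ())
                                            (λ { zero 0≢0 _ c → ⊥-elim (0≢0 refl)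
                                               ; (suc r) _ r≢j c → cong (λ q → Id q c) (punchIn-suc≡punchIn-inject₁ (r≢j ∘ cong suc)) })
                                            (λ c → cong (λ q → Id q c) (sym (punchIn-inject₁-self j)))
                                            (λ c → cong (λ q → Id q c) (punchIn-suc-self j)) ⟩
    - D (cycle (inject₁ j))           ≡⟨ cong -_ (go t (inject₁ j) (trans (toℕ-inject₁ j) (ℕP.suc-injective j≡t))) ⟩
    - (sign (inject₁ j) * D Id)       ≡⟨ cong (λ s → - (sgn s * D Id)) (toℕ-inject₁ j) ⟩
    - (sign j * D Id)                 ≡⟨ ℤP.neg-distribˡ-* (sign j) (D Id) ⟩
    sign (suc j) * D Id               ∎

det-unique : ∀ {n} {D : Mat n n → ℤ} → IsAlternating D → ∀ A → D A ≡ det A * D Id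
det-unique {zero}  {D} isAlternating A = trans (IsAlternating.≈-cong isAlternating (λ ())) (sym (ℤP.*-identityˡ (D Id)))
det-unique {suc n} {D} isAlternating A = begin
  D A                                                        ≡⟨ expand-row A zero ⟩
  sum (λ j → A zero j * D (A [ zero ]≔ Id j))                ≡⟨ sum-cong-≗ (λ j → cong (A zero j *_) (unit-first-row j)) ⟩
  sum (λ j → A zero j * (det (minor A j) * (sign j * D Id))) ≡⟨ sum-cong-≗ (λ j → rearrange (A zero j) (det (minor A j)) (sign j) (D Id)) ⟩
  sum (λ j → D Id * (sign j * (A zero j * det (minor A j)))) ≡⟨ *-distribˡ-sum (D Id) (λ j → sign j * (A zero j * det (minor A j))) ⟨
  D Id * sum (λ j → sign j * (A zero j * det (minor A j)))   ≡⟨ cong (D Id *_) (det-expand A) ⟨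
  D Id * det A                                               ≡⟨ ℤP.*-comm (D Id) (det A) ⟩
  det A * D Id                                               ∎
  where
  open Alternating isAlternating
  rearrange : ∀ a d s e → a * (d * (s * e)) ≡ e * (s * (a * d))
  rearrange a d s e = solve (a ∷ d ∷ s ∷ e ∷ [])
  -- Once the first row is e_j, clearing column j leaves the minor with a zero column inserted.
  unit-first-row : ∀ j → D (A [ zero ]≔ Id j) ≡ det (minor A j) * (sign j * D Id)
  unit-first-row j = begin
    D (A [ zero ]≔ Id j)
      ≡⟨ ≈-cong (λ { zero c → refl ; (suc r) c → refl }) ⟩
    Q (A ∘ suc)
      ≡⟨ clear-column (IsAlternating.isMultilinear Q-isAlternating) j
           (λ B r Bᵣ≡eⱼ → alternating (Id j V.∷ B) {zero} {suc r} (λ ()) (sym ∘ Bᵣ≡eⱼ)) (A ∘ suc) ⟩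
    Q (λ r → updateAt (A (suc r)) j (λ _ → + 0))
      ≡⟨ ≈-cong (λ { zero c → refl ; (suc r) c → sym (insertAt-removeAt≗updateAt (A (suc r)) j (+ 0) c) }) ⟩
    F (minor A j)
      ≡⟨ det-unique F-isAlternating (minor A j) ⟩
    det (minor A j) * F Id
      ≡⟨ cong (det (minor A j) *_) (≈-cong (λ { zero c → refl ; (suc r) c → insertAt-Id j r c })) ⟩
    det (minor A j) * D (cycle j)
      ≡⟨ cong (det (minor A j) *_) (cycle-sign isAlternating j) ⟩
    det (minor A j) * (sign j * D Id) ∎
    where
    Q : Mat n (suc n) → ℤ
    Q B = D (Id j V.∷ B)
    Q-isAlternating : IsAlternating Q
    Q-isAlternating = ∷-isAlternating isAlternating (Id j)
    F : Mat n n → ℤ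
    F C = Q (λ r → insertAt (C r) j (+ 0))
    F-isAlternating : IsAlternating F
    F-isAlternating = map-isAlternating Q-isAlternating (insertAt-isLinear j)

rowMul-isLinear : ∀ {k n} (B : Mat k n) → IsLinear (λ u → rowMul u B)
rowMul-isLinear B = record
  { ≗-cong = λ u≗v c → sum-cong-≗ (λ l → cong (_* B l c) (u≗v l))
  ; linear = λ x y u v c → trans (sum-cong-≗ (λ l → distrib x y (u l) (v l) (B l c)))
                                 (sum-linear x y (λ l → u l * B l c) (λ l → v l * B l c))
  }
  where
  distrib : ∀ x y a b e → (x * a + y * b) * e ≡ x * (a * e) + y * (b * e)
  distrib x y a b e = solve (x ∷ y ∷ a ∷ b ∷ e ∷ [])

det-⊗ : ∀ {n} (A B : Mat n n) → det (A ⊗ B) ≡ det A * det B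
det-⊗ A B = begin
  det (A ⊗ B)   ≡⟨ det-cong (⊗-sum A B) ⟩
  D A           ≡⟨ det-unique (map-isAlternating det-isAlternating (rowMul-isLinear B)) A ⟩
  det A * D Id  ≡⟨ cong (det A *_) (det-cong (λ i j → trans (sym (⊗-sum Id B i j)) (⊗-identityˡ B i j))) ⟩
  det A * det B ∎
  where
  D : Mat _ _ → ℤ
  D X = det (λ i → rowMul (X i) B)

IsUnit : ℤ → Set
IsUnit u = ∣ u ∣ ≡ 1

*≡1⇒isUnit : ∀ a b → a * b ≡ + 1 → IsUnit a
*≡1⇒isUnit a b ab≡1 = ℕP.m*n≡1⇒m≡1 ∣ a ∣ ∣ b ∣ (trans (sym (ℤP.abs-* a b)) (cong ∣_∣ ab≡1))

isUnit⇒nonZero : ∀ {u} → IsUnit u → ℤ.NonZero u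
isUnit⇒nonZero ∣u∣≡1 = subst ℕ.NonZero (sym ∣u∣≡1) _

unimodular-neg : ∀ {x} → IsUnimodularValue x → IsUnimodularValue (- x)
unimodular-neg (inj₁ refl)        = inj₂ (inj₂ refl)
unimodular-neg (inj₂ (inj₁ refl)) = inj₂ (inj₁ refl)
unimodular-neg (inj₂ (inj₂ refl)) = inj₁ refl

unimodular-*-unit : ∀ {x u} → IsUnimodularValue x → IsUnit u → IsUnimodularValue (x * u)
unimodular-*-unit {x} {+ .1}      x-uni refl = subst IsUnimodularValue (sym (ℤP.*-identityʳ x)) x-uni
unimodular-*-unit {x} { -[1+ 0 ]} x-uni refl =
  subst IsUnimodularValue (sym (trans (ℤP.*-comm x (ℤ.- + 1)) (ℤP.-1*i≡-i x))) (unimodular-neg x-uni)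

det-inverse : ∀ {n} {A B : Mat n n} → B ⊗ A ≈ Id → det B * det A ≡ + 1
det-inverse {n} {A} {B} BA≈Id = trans (sym (det-⊗ B A)) (trans (det-cong BA≈Id) (det-Id {n}))

det-[]≔-row : ∀ {n} (A : Mat n n) i j → det (A [ j ]≔ A i) ≡ Id i j * det A
det-[]≔-row A i j = by-cases (i ≟ j)
  where
  by-cases : Dec (i ≡ j) → det (A [ j ]≔ A i) ≡ Id i j * det A
  by-cases (yes refl) = trans (det-cong ([]≔-self A i))
    (sym (trans (cong (_* det A) (Id-diag i)) (ℤP.*-identityˡ (det A))))
  by-cases (no i≢j)   = trans
    (det-alternating (A [ j ]≔ A i) i≢j (λ c → trans ([]≔-minimal A (A i) i≢j c) (sym ([]≔-updates A j (A i) c))))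
    (sym (cong (_* det A) (Id-off i≢j)))

det-Id-[]≔ : ∀ {n} j (v : Fin n → ℤ) → det (Id [ j ]≔ v) ≡ v j
det-Id-[]≔ {n} j v = begin
  det (Id [ j ]≔ v)                                      ≡⟨ expand-row (Id [ j ]≔ v) j ⟩
  sum (λ t → (Id [ j ]≔ v) j t * det (Id [ j ]≔ v [ j ]≔ Id t))
                                                         ≡⟨ sum-cong-≗ (λ t → cong₂ _*_ ([]≔-updates Id j v t) (det-cong ([]≔-idem Id j v (Id t)))) ⟩
  sum (λ t → v t * det (Id [ j ]≔ Id t))                 ≡⟨ sum-cong-≗ (λ t → cong (v t *_) (det-[]≔-row Id t j)) ⟩
  sum (λ t → v t * (Id t j * det (Id {n})))              ≡⟨ sum-cong-≗ (λ t → cong (λ d → v t * (Id t j * d)) (det-Id {n})) ⟩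
  sum (λ t → v t * (Id t j * + 1))                       ≡⟨ sum-cong-≗ (λ t → cong (v t *_) (ℤP.*-identityʳ (Id t j))) ⟩
  sum (λ t → v t * Id t j)                               ≡⟨ sum-*-Id v j ⟩
  v j                                                    ∎
  where open Multilinear det-isMultilinear using (expand-row)

-- Entry (i, j) of A B is det (Id [ j ]≔ (A B) i), and multiplying that matrix by A
-- gives A [ j ]≔ A i because B A = Id.
⊗-inverse-comm : ∀ {n} {A B : Mat n n} → B ⊗ A ≈ Id → A ⊗ B ≈ Id
⊗-inverse-comm {n} {A} {B} BA≈Id i j = ℤP.*-cancelʳ-≡ ((A ⊗ B) i j) (Id i j) (det A) {{det-A≢0}} (begin
  (A ⊗ B) i j * det A ≡⟨ cong (_* det A) (det-Id-[]≔ j ((A ⊗ B) i)) ⟨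
  det Y * det A       ≡⟨ det-⊗ Y A ⟨
  det (Y ⊗ A)         ≡⟨ det-cong YA≈ ⟩
  det (A [ j ]≔ A i)  ≡⟨ det-[]≔-row A i j ⟩
  Id i j * det A      ∎)
  where
  det-A≢0 : ℤ.NonZero (det A)
  det-A≢0 = isUnit⇒nonZero {det A} (*≡1⇒isUnit (det A) (det B) (trans (ℤP.*-comm (det A) (det B)) (det-inverse BA≈Id)))
  Y : Mat n n
  Y = Id [ j ]≔ (A ⊗ B) i
  YA≈ : Y ⊗ A ≈ A [ j ]≔ A i
  YA≈ r c = by-cases (r ≟ j)
    where
    by-cases : Dec (r ≡ j) → (Y ⊗ A) r c ≡ (A [ j ]≔ A i) r c
    by-cases (yes refl) = begin
      (Y ⊗ A) r c                        ≡⟨ ⊗-sum Y A r c ⟩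
      sum (λ l → Y r l * A l c)          ≡⟨ sum-cong-≗ (λ l → cong (_* A l c) ([]≔-updates Id r ((A ⊗ B) i) l)) ⟩
      sum (λ l → (A ⊗ B) i l * A l c)    ≡⟨ ⊗-sum (A ⊗ B) A i c ⟨
      ((A ⊗ B) ⊗ A) i c                  ≡⟨ ⊗-assoc A B A i c ⟩
      (A ⊗ (B ⊗ A)) i c                  ≡⟨ ⊗-congʳ A BA≈Id i c ⟩
      (A ⊗ Id) i c                       ≡⟨ ⊗-identityʳ A i c ⟩
      A i c                              ≡⟨ []≔-updates A r (A i) c ⟨
      (A [ r ]≔ A i) r c                 ∎
    by-cases (no r≢j) = begin
      (Y ⊗ A) r c                        ≡⟨ ⊗-sum Y A r c ⟩
      sum (λ l → Y r l * A l c)          ≡⟨ sum-cong-≗ (λ l → cong (_* A l c) ([]≔-minimal Id ((A ⊗ B) i) r≢j l)) ⟩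
      sum (λ l → Id r l * A l c)         ≡⟨ ⊗-sum Id A r c ⟨
      (Id ⊗ A) r c                       ≡⟨ ⊗-identityˡ A r c ⟩
      A r c                              ≡⟨ []≔-minimal A (A i) r≢j c ⟨
      (A [ j ]≔ A i) r c                 ∎

-- Total unimodularity

columnSelection : ∀ {k n} → (Fin k → Fin n) → Mat n k
columnSelection c l j = Id l (c j)

submatrix≈rows⊗columnSelection : ∀ {m n k} (A : Mat m n) r (c : Fin k → Fin n) →
  submatrix A r c ≈ rowsOf A r ⊗ columnSelection c
submatrix≈rows⊗columnSelection A r c i j = sym (trans (⊗-sum (rowsOf A r) (columnSelection c) i j) (sum-*-Id (A (r i)) (c j)))

columnSelection-isUnit : ∀ {n} {c : Fin n → Fin n} → Injective _≡_ _≡_ c → IsUnit (det (columnSelection c))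
columnSelection-isUnit {n} {c} c-inj =
  *≡1⇒isUnit (det P) (det Pᵀ) (trans (ℤP.*-comm (det P) (det Pᵀ)) (det-inverse PᵀP≈Id))
  where
  P Pᵀ : Mat n n
  P = columnSelection c
  Pᵀ i l = P l i
  PᵀP≈Id : Pᵀ ⊗ P ≈ Id
  PᵀP≈Id i j = trans (⊗-sum Pᵀ P i j) (trans (sum-*-Id (λ l → Id l (c i)) (c j)) (trans (Id-injective c-inj j i) (Id-sym j i)))

det-maximalMinor-⊗ : ∀ {m n} (M : Mat m n) (X : Mat n n) r c →
  det (submatrix (M ⊗ X) r c) ≡ det (rowsOf M r) * det X * det (columnSelection c)
det-maximalMinor-⊗ M X r c = begin
  det (submatrix (M ⊗ X) r c)                      ≡⟨ det-cong (submatrix≈rows⊗columnSelection (M ⊗ X) r c) ⟩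
  det ((rowsOf M r ⊗ X) ⊗ columnSelection c)       ≡⟨ det-⊗ (rowsOf M r ⊗ X) (columnSelection c) ⟩
  det (rowsOf M r ⊗ X) * det (columnSelection c)   ≡⟨ cong (_* det (columnSelection c)) (det-⊗ (rowsOf M r) X) ⟩
  det (rowsOf M r) * det X * det (columnSelection c) ∎

∷-injective : ∀ {k p} {a : Fin p} {g : Fin k → Fin p} → Injective _≡_ _≡_ g → ¬ (∃ λ s → g s ≡ a) →
  Injective _≡_ _≡_ (a V.∷ g)
∷-injective g-inj a∉g {zero}  {zero}  _   = refl
∷-injective g-inj a∉g {zero}  {suc y} a≡g = ⊥-elim (a∉g (y , sym a≡g))
∷-injective g-inj a∉g {suc x} {zero}  g≡a = ⊥-elim (a∉g (x , g≡a))
∷-injective g-inj a∉g {suc x} {suc y} g≡g = cong suc (g-inj g≡g)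

∃-missing : ∀ {k n} → k ℕ.< n → (c : Fin k → Fin n) → Injective _≡_ _≡_ c → ∃ λ t → ¬ (∃ λ s → c s ≡ t)
∃-missing {k} {n} k<n c c-inj = ¬∀⟶∃¬ n _ (λ t → any? (λ s → c s ≟ t)) not-onto
  where
  not-onto : ¬ (∀ t → ∃ λ s → c s ≡ t)
  not-onto onto with pigeonhole k<n (proj₁ ∘ onto)
  ... | i , j , i<j , sᵢ≡sⱼ = <⇒≢ i<j (trans (sym (proj₂ (onto i))) (trans (cong c sᵢ≡sⱼ) (proj₂ (onto j))))

maximalMinors⇒totallyUnimodular : ∀ {m n} (A : Mat m n) (f : Fin n → Fin m) →
  (∀ t c → A (f t) c ≡ Id t c) →
  (∀ (r : Fin n → Fin m) (c : Fin n → Fin n) → Injective _≡_ _≡_ r → Injective _≡_ _≡_ c →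
     IsUnimodularValue (det (submatrix A r c))) →
  TotallyUnimodular A
maximalMinors⇒totallyUnimodular {m} {n} A f A∘f≈Id maximal k r c r-inj c-inj with k ℕP.≤? n
... | yes k≤n = extend (n ℕ.∸ k) r c r-inj c-inj (ℕP.m∸n+n≡m k≤n)
  where
  extend : ∀ d {k} (r : Fin k → Fin m) (c : Fin k → Fin n) → Injective _≡_ _≡_ r → Injective _≡_ _≡_ c →
    d ℕ.+ k ≡ n → IsUnimodularValue (det (submatrix A r c))
  extend zero    r c r-inj c-inj refl = maximal r c r-inj c-inj
  extend (suc d) {k} r c r-inj c-inj d+k≡n = border (∃-missing k<n c c-inj)
    where
    k<n : k ℕ.< n
    k<n = subst (k ℕ.<_) d+k≡n (ℕP.m<n+m k {suc d} (ℕ.s≤s ℕ.z≤n))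
    border : (∃ λ t → ¬ (∃ λ s → c s ≡ t)) → IsUnimodularValue (det (submatrix A r c))
    border (t , t∉c) = by-cases (any? (λ i → r i ≟ f t))
      where
      fₜ-off : ∀ s → A (f t) (c s) ≡ + 0
      fₜ-off s = trans (A∘f≈Id t (c s)) (Id-off (λ t≡cₛ → t∉c (s , sym t≡cₛ)))
      bordered : det (submatrix A (f t V.∷ r) (t V.∷ c)) ≡ det (submatrix A r c)
      bordered = begin
        det (submatrix A (f t V.∷ r) (t V.∷ c)) ≡⟨ det-firstRow-diagonal (submatrix A (f t V.∷ r) (t V.∷ c)) fₜ-off ⟩
        A (f t) t * det (submatrix A r c)        ≡⟨ cong (_* det (submatrix A r c)) (trans (A∘f≈Id t t) (Id-diag t)) ⟩
        + 1 * det (submatrix A r c)              ≡⟨ ℤP.*-identityˡ (det (submatrix A r c)) ⟩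
        det (submatrix A r c)                    ∎
      by-cases : Dec (∃ λ i → r i ≡ f t) → IsUnimodularValue (det (submatrix A r c))
      by-cases (yes (i , rᵢ≡fₜ)) = inj₂ (inj₁ (Multilinear.zero-row det-isMultilinear (submatrix A r c) i
        (λ s → trans (cong (λ q → A q (c s)) rᵢ≡fₜ) (fₜ-off s))))
      by-cases (no fₜ∉r)         = subst IsUnimodularValue bordered
        (extend d (f t V.∷ r) (t V.∷ c) (∷-injective r-inj fₜ∉r) (∷-injective c-inj t∉c) (trans (ℕP.+-suc d k) d+k≡n))
... | no k≰n with pigeonhole (ℕP.≰⇒> k≰n) c
...   | i , j , i<j , cᵢ≡cⱼ = ⊥-elim (<⇒≢ i<j (c-inj cᵢ≡cⱼ))

proposition1 : ∀ (m n : ℕ) (M : Mat m n) →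
    IsSmoothFanoCoordMatrix M → IsUnimodularPolytope M →
    ∀ (S : Subset m) → IsFacet M S →
    ∀ (f : Fin n → Fin m) → Enumerates f S →
    ∀ (Ninv : Mat n n) → (∀ i j → (Ninv ⊗ rowsOf M f) i j ≡ Id i j) →
    TotallyUnimodular (M ⊗ Ninv)
proposition1 m n M _ unimodular _ _ f _ Ninv Ninv⊗N≈Id =
  maximalMinors⇒totallyUnimodular (M ⊗ Ninv) f (⊗-inverse-comm {A = rowsOf M f} {Ninv} Ninv⊗N≈Id) maximal-minor
  where
  det-Ninv-isUnit : IsUnit (det Ninv)
  det-Ninv-isUnit = *≡1⇒isUnit (det Ninv) (det (rowsOf M f)) (det-inverse Ninv⊗N≈Id)
  maximal-minor : ∀ r c → Injective _≡_ _≡_ r → Injective _≡_ _≡_ c →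
    IsUnimodularValue (det (submatrix (M ⊗ Ninv) r c))
  maximal-minor r c r-inj c-inj = subst IsUnimodularValue (sym (det-maximalMinor-⊗ M Ninv r c))
    (unimodular-*-unit (unimodular-*-unit (unimodular r r-inj) det-Ninv-isUnit) (columnSelection-isUnit c-inj))
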